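{- Let $\mathbb{F}$ be a finite field, let $A\in\mathbb{F}^{n\times d}$ with $n\ge d$, and let $k=d-1$. Then \[\min_{U\in\mathbb{F}^{n\times k},\,V\in\mathbb{F}^{k\times d}}\|UV-A\|_0=\min_{x\in\mathbb{F}^d,\ x\neq0}\|Ax\|_0.\]
   Context: For a matrix or vector $M$ over $\mathbb{F}$, $\|M\|_0$ denotes the number of nonzero entries of $M$. -}

module Defs where

open import Level using (Level; _⊔_)
open import Algebra.Bundles using (CommutativeRing)
open import Data.Nat using (ℕ; zero; suc; _≤_) renaming (_+_ to _+ℕ_)
open import Data.Fin using (Fin; zero; suc)
open import Data.Product using (Σ; ∃; _×_; _,_)
open import Function.Bundles using (Surjection)
open import Relation.Binary.PropositionalEquality using (_≡_) renaming (setoid to ≡-setoid)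
open import Relation.Binary.Definitions using (Decidable)
open import Relation.Nullary using (¬_; yes; no)

record FiniteField (c ℓ : Level) : Set (Level.suc (c ⊔ ℓ)) where
  field
    commutativeRing : CommutativeRing c ℓ
  open CommutativeRing commutativeRing public
  field
    _≟_        : Decidable _≈_
    1≉0        : ¬ (1# ≈ 0#)
    inverse    : ∀ x → ¬ (x ≈ 0#) → Σ Carrier λ y → x * y ≈ 1#
    size       : ℕ
    enumerate  : Surjection (≡-setoid (Fin size)) setoid

module Matrices {c ℓ : Level} (F : FiniteField c ℓ) where
  open FiniteField F using (Carrier; _≈_; _+_; _*_; _-_; 0#; _≟_)

  Matrix : ℕ → ℕ → Set c
  Matrix m n = Fin m → Fin n → Carrier

  Vector : ℕ → Set c
  Vector n = Fin n → Carrier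

  ∑ : ∀ {n} → (Fin n → Carrier) → Carrier
  ∑ {zero}  f = 0#
  ∑ {suc n} f = f zero + ∑ (λ i → f (suc i))

  _·_ : ∀ {m k n} → Matrix m k → Matrix k n → Matrix m n
  (U · V) i j = ∑ (λ t → U i t * V t j)

  _⊖_ : ∀ {m n} → Matrix m n → Matrix m n → Matrix m n
  (M ⊖ N) i j = M i j - N i j

  _▷_ : ∀ {m n} → Matrix m n → Vector n → Vector m
  (A ▷ x) i = ∑ (λ j → A i j * x j)

  nnzV : ∀ {n} → Vector n → ℕ
  nnzV {zero}  v = zero
  nnzV {suc n} v with v zero ≟ 0#
  ... | yes _ = nnzV (λ i → v (suc i))
  ... | no  _ = suc (nnzV (λ i → v (suc i)))

  nnz : ∀ {m n} → Matrix m n → ℕ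
  nnz {zero}  M = zero
  nnz {suc m} M = nnzV (M zero) +ℕ nnz (λ i → M (suc i))

  zeroV : ∀ {n} → Vector n
  zeroV _ = 0#

  NonZeroV : ∀ {n} → Vector n → Set ℓ
  NonZeroV x = ¬ (∀ j → x j ≈ 0#)

IsMinOn : ∀ {a p} {X : Set a} → (X → Set p) → (X → ℕ) → ℕ → Set (a ⊔ p)
IsMinOn {X = X} P f m = (Σ X λ x → P x × f x ≡ m) × (∀ x → P x → m ≤ f x)

IsMin : ∀ {a} {X : Set a} → (X → ℕ) → ℕ → Set a
IsMin {X = X} f m = (Σ X λ x → f x ≡ m) × (∀ x → m ≤ f x)

module Submission where

-- If V x = 0 for some x ≠ 0, which happens for every V with fewer rows than
-- columns, then each row i with (A x)ᵢ ≠ 0 contains a nonzero entry of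
-- UV − A (since (UV − A) x = − A x), so ‖UV − A‖₀ ≥ ‖A x‖₀. Conversely, take
-- a minimiser x and j with xⱼ ≠ 0. The projection P = I − x eⱼᵀ / xⱼ has a
-- zero j-th row, so A P factors through k = d − 1 dimensions (drop column j
-- of A and row j of P), and A P − A = − (A x) eⱼᵀ / xⱼ has exactly ‖A x‖₀
-- nonzero entries.

open import Defs
open import Level using (Level)
open import Function using (_∘_; flip; case_of_)
open import Data.Nat using (ℕ; zero; suc; _≤_; z≤n; s≤s) renaming (_+_ to _+ℕ_; _*_ to _*ℕ_)
open import Data.Nat.Properties using (≤-refl; ≤-reflexive; ≤-trans; +-mono-≤; m≤n+m) renaming (*-identityʳ to ℕ-*-identityʳ)
open import Data.Fin using (Fin; zero; suc; punchIn; punchOut)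
open import Data.Fin.Properties using (punchIn-punchOut; all?; ¬∀⟶∃¬)
import Data.Fin as Fin
open import Data.Product using (Σ; _×_; _,_; proj₁; proj₂; uncurry)
open import Data.List using (List; []; _∷_; map; filter; allFin; cartesianProductWith)
open import Data.List.Membership.Propositional using (_∈_)
open import Data.List.Membership.Propositional.Properties
  using (∈-filter⁺; ∈-map⁺; ∈-allFin; ∈-cartesianProductWith⁺)
open import Data.List.Relation.Unary.Any using (here)
import Data.List.Relation.Unary.All as All
open import Data.List.Relation.Unary.All.Properties using (all-filter)
open import Data.List.Extrema.Nat using (argmin; argmin-all; f[argmin]≤f[xs])
open import Data.Vec.Functional using (removeAt) renaming ([] to []ᵥ; _∷_ to _∷ᵥ_)
open import Function.Bundles using (Surjection)
open import Relation.Nullary using (¬_; ¬?; yes; no; contradiction)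
open import Relation.Unary using (Decidable)
open import Relation.Binary.PropositionalEquality as ≡ using (_≡_)
import Algebra.Properties.Semiring.Sum as SemiringSum
import Algebra.Properties.Group as GroupProperties
import Algebra.Properties.Ring as RingProperties
import Data.Vec.Functional.Relation.Binary.Equality.Setoid as PointwiseEquality

minimum-from-cover : ∀ {a p} {X : Set a} (P : X → Set p) → Decidable P → (g : X → ℕ) →
                     (xs : List X) → (∀ x → P x → Σ X λ y → y ∈ xs × P y × g y ≤ g x) →
                     ∀ x₀ → P x₀ → Σ ℕ (IsMinOn P g)
minimum-from-cover P P? g xs cover x₀ Px₀ =
  g x* , (x* , argmin-all g Px₀ (all-filter P? xs) , ≡.refl) , minimal
  where
  x* = argmin g x₀ (filter P? xs)
  minimal : ∀ x → P x → g x* ≤ g x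
  minimal x Px with cover x Px
  ... | y , y∈xs , Py , gy≤gx =
    ≤-trans (All.lookup (f[argmin]≤f[xs] x₀ (filter P? xs)) (∈-filter⁺ P? y∈xs Py)) gy≤gx

module LowRankApproximation {c ℓ : Level} (F : FiniteField c ℓ) where
  open FiniteField F hiding (zero)
  open Matrices F
  open PointwiseEquality setoid using (_≋_)
  open GroupProperties +-group using (x∙y⁻¹≈ε⇒x≈y; ⁻¹-involutive)
  open import Relation.Binary.Reasoning.Setoid setoid
  open RingProperties ring using (-‿distribˡ-*; -‿distribʳ-*; xyx⁻¹≈y)

  module Sum = SemiringSum semiring

  ∑≡sum : ∀ {n} (f : Vector n) → ∑ f ≡ Sum.sum f
  ∑≡sum {zero}  f = ≡.refl
  ∑≡sum {suc n} f = ≡.cong (f zero +_) (∑≡sum (f ∘ suc))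

  ∑-cong : ∀ {n} {f g : Vector n} → f ≋ g → ∑ f ≈ ∑ g
  ∑-cong {f = f} {g} f≋g rewrite ∑≡sum f | ∑≡sum g = Sum.sum-cong-≋ f≋g

  ∑-zero : ∀ {n} (f : Vector n) → (∀ i → f i ≈ 0#) → ∑ f ≈ 0#
  ∑-zero {n} f f≈0 =
    trans (∑-cong f≈0) (trans (reflexive (∑≡sum {n} (λ _ → 0#))) (Sum.sum-replicate-zero n))

  ∑-distrib-+ : ∀ {n} (f g : Vector n) → ∑ (λ i → f i + g i) ≈ ∑ f + ∑ g
  ∑-distrib-+ f g rewrite ∑≡sum (λ i → f i + g i) | ∑≡sum f | ∑≡sum g = Sum.∑-distrib-+ f g

  *-distribˡ-∑ : ∀ {n} a (f : Vector n) → a * ∑ f ≈ ∑ (λ i → a * f i)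
  *-distribˡ-∑ a f rewrite ∑≡sum f | ∑≡sum (λ i → a * f i) = Sum.*-distribˡ-sum a f

  *-distribʳ-∑ : ∀ {n} a (f : Vector n) → ∑ f * a ≈ ∑ (λ i → f i * a)
  *-distribʳ-∑ a f rewrite ∑≡sum f | ∑≡sum (λ i → f i * a) = Sum.*-distribʳ-sum a f

  ∑-comm : ∀ {m n} (f : Fin m → Fin n → Carrier) →
           ∑ (λ i → ∑ (λ j → f i j)) ≈ ∑ (λ j → ∑ (λ i → f i j))
  ∑-comm f = begin
    ∑ (λ i → ∑ (f i))                    ≡⟨ ∑∑≡sumsum f ⟩
    Sum.sum (λ i → Sum.sum (f i))        ≈⟨ Sum.∑-comm f ⟩
    Sum.sum (λ j → Sum.sum (flip f j))   ≡⟨ ∑∑≡sumsum (flip f) ⟨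
    ∑ (λ j → ∑ (flip f j))               ∎
    where
    ∑∑≡sumsum : ∀ {m n} (g : Fin m → Fin n → Carrier) →
                ∑ (λ i → ∑ (g i)) ≡ Sum.sum (λ i → Sum.sum (g i))
    ∑∑≡sumsum g = ≡.trans (∑≡sum (λ i → ∑ (g i))) (Sum.sum-cong-≗ (λ i → ∑≡sum (g i)))

  ∑-remove : ∀ {n} (j : Fin (suc n)) (f : Vector (suc n)) → ∑ f ≈ f j + ∑ (removeAt f j)
  ∑-remove j f rewrite ∑≡sum f | ∑≡sum (removeAt f j) = Sum.sum-remove f

  1ᴹ : ∀ {n} → Matrix n n
  1ᴹ zero    zero    = 1#
  1ᴹ zero    (suc _) = 0#
  1ᴹ (suc _) zero    = 0#
  1ᴹ (suc i) (suc j) = 1ᴹ i j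

  1ᴹ-sym : ∀ {n} (i j : Fin n) → 1ᴹ i j ≡ 1ᴹ j i
  1ᴹ-sym zero    zero    = ≡.refl
  1ᴹ-sym zero    (suc _) = ≡.refl
  1ᴹ-sym (suc _) zero    = ≡.refl
  1ᴹ-sym (suc i) (suc j) = 1ᴹ-sym i j

  _⊗_ : ∀ {m n} → Vector m → Vector n → Matrix m n
  (w ⊗ y) i j = w i * y j

  ▷-1ᴹ : ∀ {m n} (M : Matrix m n) (j : Fin n) → M ▷ 1ᴹ j ≋ λ i → M i j
  ▷-1ᴹ M zero    i = trans (+-cong (*-identityʳ _) (∑-zero (λ c → M i (suc c) * 0#) (λ _ → zeroʳ _))) (+-identityʳ _)
  ▷-1ᴹ M (suc j) i = trans (+-cong (zeroʳ _) (▷-1ᴹ (λ i → M i ∘ suc) j i)) (+-identityˡ _)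

  ·-identityʳ : ∀ {m n} (A : Matrix m n) i j → (A · 1ᴹ) i j ≈ A i j
  ·-identityʳ A i j =
    trans (∑-cong (λ t → *-congˡ (reflexive (1ᴹ-sym t j)))) (▷-1ᴹ A j i)

  ·-⊗ : ∀ {m n p} (A : Matrix m n) (x : Vector n) (y : Vector p) →
        ∀ i j → (A · (x ⊗ y)) i j ≈ ((A ▷ x) ⊗ y) i j
  ·-⊗ A x y i j = begin
    ∑ (λ t → A i t * (x t * y j))   ≈⟨ ∑-cong (λ t → sym (*-assoc (A i t) (x t) (y j))) ⟩
    ∑ (λ t → A i t * x t * y j)     ≈⟨ *-distribʳ-∑ (y j) (λ t → A i t * x t) ⟨
    (A ▷ x) i * y j                 ∎

  ▷-congʳ : ∀ {m n} (A : Matrix m n) {x y : Vector n} → x ≋ y → A ▷ x ≋ A ▷ y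
  ▷-congʳ A x≋y i = ∑-cong (λ j → *-congˡ (x≋y j))

  ·-▷ : ∀ {m k n} (U : Matrix m k) (V : Matrix k n) (x : Vector n) →
        (U · V) ▷ x ≋ U ▷ (V ▷ x)
  ·-▷ U V x i = begin
    ∑ (λ j → ∑ (λ t → U i t * V t j) * x j)   ≈⟨ ∑-cong (λ j → *-distribʳ-∑ (x j) (λ t → U i t * V t j)) ⟩
    ∑ (λ j → ∑ (λ t → U i t * V t j * x j))   ≈⟨ ∑-comm (λ j t → U i t * V t j * x j) ⟩
    ∑ (λ t → ∑ (λ j → U i t * V t j * x j))   ≈⟨ ∑-cong (λ t → ∑-cong (λ j → *-assoc (U i t) (V t j) (x j))) ⟩
    ∑ (λ t → ∑ (λ j → U i t * (V t j * x j))) ≈⟨ ∑-cong (λ t → *-distribˡ-∑ (U i t) (λ j → V t j * x j)) ⟨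
    ∑ (λ t → U i t * (V ▷ x) t)               ∎

  ·-removeAt : ∀ {m k n} (A : Matrix m (suc k)) (M : Matrix (suc k) n) (j : Fin (suc k)) →
               (∀ c → M j c ≈ 0#) → ∀ i c → ((λ i → removeAt (A i) j) · removeAt M j) i c ≈ (A · M) i c
  ·-removeAt A M j Mⱼ≈0 i c = sym (begin
    ∑ (λ t → A i t * M t c)                            ≈⟨ ∑-remove j (λ t → A i t * M t c) ⟩
    A i j * M j c + ∑ (removeAt (λ t → A i t * M t c) j) ≈⟨ +-congʳ (trans (*-congˡ (Mⱼ≈0 c)) (zeroʳ _)) ⟩
    0# + ∑ (removeAt (λ t → A i t * M t c) j)          ≈⟨ +-identityˡ _ ⟩
    ∑ (removeAt (λ t → A i t * M t c) j)               ∎)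

  unit⇒≉0 : ∀ {a b} → a * b ≈ 1# → ¬ a ≈ 0#
  unit⇒≉0 {a} {b} ab≈1 a≈0 = 1≉0 (begin
    1#     ≈⟨ ab≈1 ⟨
    a * b  ≈⟨ *-congʳ a≈0 ⟩
    0# * b ≈⟨ zeroˡ b ⟩
    0#     ∎)

  x*y≈0⇒y≈0 : ∀ {a b} → ¬ a ≈ 0# → a * b ≈ 0# → b ≈ 0#
  x*y≈0⇒y≈0 {a} {b} a≉0 ab≈0 with inverse a a≉0
  ... | a⁻¹ , aa⁻¹≈1 = begin
    b              ≈⟨ *-identityˡ b ⟨
    1# * b         ≈⟨ *-congʳ (trans (*-comm a⁻¹ a) aa⁻¹≈1) ⟨
    a⁻¹ * a * b    ≈⟨ *-assoc a⁻¹ a b ⟩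
    a⁻¹ * (a * b)  ≈⟨ *-congˡ ab≈0 ⟩
    a⁻¹ * 0#       ≈⟨ zeroʳ a⁻¹ ⟩
    0#             ∎

  -‿unit : ∀ {a b} → a * b ≈ 1# → - a * - b ≈ 1#
  -‿unit {a} {b} ab≈1 = begin
    - a * - b     ≈⟨ -‿distribˡ-* a (- b) ⟨
    - (a * - b)   ≈⟨ -‿cong (-‿distribʳ-* a b) ⟨
    - - (a * b)   ≈⟨ ⁻¹-involutive (a * b) ⟩
    a * b         ≈⟨ ab≈1 ⟩
    1#            ∎

  x+a*-b*x≈0 : ∀ {a b} → a * b ≈ 1# → ∀ x → x + a * - b * x ≈ 0#
  x+a*-b*x≈0 {a} {b} ab≈1 x = begin
    x + a * - b * x    ≈⟨ +-congˡ (*-congʳ (-‿distribʳ-* a b)) ⟨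
    x + - (a * b) * x  ≈⟨ +-congˡ (*-congʳ (-‿cong ab≈1)) ⟩
    x + - 1# * x       ≈⟨ +-congˡ (-‿distribˡ-* 1# x) ⟨
    x + - (1# * x)     ≈⟨ +-congˡ (-‿cong (*-identityˡ x)) ⟩
    x - x              ≈⟨ -‿inverseʳ x ⟩
    0#                 ∎

  nnzV-cong-support : ∀ {n} {v w : Vector n} → (∀ i → v i ≈ 0# → w i ≈ 0#) →
                      (∀ i → w i ≈ 0# → v i ≈ 0#) → nnzV v ≡ nnzV w
  nnzV-cong-support {zero}  _ _ = ≡.refl
  nnzV-cong-support {suc n} {v} {w} v⇒w w⇒v with v zero ≟ 0# | w zero ≟ 0#
  ... | yes _    | yes _    = nnzV-cong-support (v⇒w ∘ suc) (w⇒v ∘ suc)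
  ... | no _     | no _     = ≡.cong suc (nnzV-cong-support (v⇒w ∘ suc) (w⇒v ∘ suc))
  ... | yes v₀≈0 | no w₀≉0  = contradiction (v⇒w zero v₀≈0) w₀≉0
  ... | no v₀≉0  | yes w₀≈0 = contradiction (w⇒v zero w₀≈0) v₀≉0

  nnzV-cong : ∀ {n} {v w : Vector n} → v ≋ w → nnzV v ≡ nnzV w
  nnzV-cong v≋w =
    nnzV-cong-support (λ i vᵢ≈0 → trans (sym (v≋w i)) vᵢ≈0) (λ i wᵢ≈0 → trans (v≋w i) wᵢ≈0)

  nnz-cong : ∀ {m n} {M N : Matrix m n} → (∀ i j → M i j ≈ N i j) → nnz M ≡ nnz N
  nnz-cong {zero}  _   = ≡.refl
  nnz-cong {suc m} M≈N = ≡.cong₂ _+ℕ_ (nnzV-cong (M≈N zero)) (nnz-cong (M≈N ∘ suc))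

  nnzV-zero : ∀ {n} {v : Vector n} → (∀ i → v i ≈ 0#) → nnzV v ≡ 0
  nnzV-zero {zero}      _   = ≡.refl
  nnzV-zero {suc n} {v} v≈0 with v zero ≟ 0#
  ... | yes _   = nnzV-zero (v≈0 ∘ suc)
  ... | no v₀≉0 = contradiction (v≈0 zero) v₀≉0

  nnzV-pos : ∀ {n} {v : Vector n} → NonZeroV v → 1 ≤ nnzV v
  nnzV-pos {zero}      v≉0 = contradiction (λ ()) v≉0
  nnzV-pos {suc n} {v} v≉0 with v zero ≟ 0#
  ... | yes v₀≈0 = nnzV-pos (λ v′≈0 → v≉0 λ { zero → v₀≈0 ; (suc i) → v′≈0 i })
  ... | no _     = s≤s z≤n

  nnzV-1ᴹ : ∀ {n} (j : Fin n) → nnzV (1ᴹ j) ≡ 1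
  nnzV-1ᴹ {suc n} zero with 1# ≟ 0#
  ... | yes 1≈0 = contradiction 1≈0 1≉0
  ... | no _    = ≡.cong suc (nnzV-zero {n} (λ _ → refl))
  nnzV-1ᴹ (suc j) with 0# ≟ 0#
  ... | yes _   = nnzV-1ᴹ j
  ... | no 0≉0  = contradiction refl 0≉0

  1ᴹ-nonzero : ∀ {n} (j : Fin n) → NonZeroV (1ᴹ j)
  1ᴹ-nonzero j 1ᴹⱼ≈0 = case ≡.trans (≡.sym (nnzV-1ᴹ j)) (nnzV-zero 1ᴹⱼ≈0) of λ ()

  nnzV-≤-nnz : ∀ {m n} {w : Vector m} {M : Matrix m n} →
               (∀ i → (∀ c → M i c ≈ 0#) → w i ≈ 0#) → nnzV w ≤ nnz M
  nnzV-≤-nnz {zero}              _    = z≤n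
  nnzV-≤-nnz {suc m} {w = w} {M} Mᵢ≈0⇒wᵢ≈0 with w zero ≟ 0#
  ... | yes _   = ≤-trans (nnzV-≤-nnz (Mᵢ≈0⇒wᵢ≈0 ∘ suc)) (m≤n+m _ (nnzV (M zero)))
  ... | no w₀≉0 = +-mono-≤ (nnzV-pos (w₀≉0 ∘ Mᵢ≈0⇒wᵢ≈0 zero)) (nnzV-≤-nnz (Mᵢ≈0⇒wᵢ≈0 ∘ suc))

  nnzV-*ₗ : ∀ {n} {a} (v : Vector n) → ¬ a ≈ 0# → nnzV (λ i → a * v i) ≡ nnzV v
  nnzV-*ₗ {a = a} v a≉0 =
    nnzV-cong-support {w = v} (λ i → x*y≈0⇒y≈0 a≉0) (λ i vᵢ≈0 → trans (*-congˡ vᵢ≈0) (zeroʳ a))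

  nnz-⊗ : ∀ {m n} (w : Vector m) (y : Vector n) → nnz (w ⊗ y) ≡ nnzV w *ℕ nnzV y
  nnz-⊗ {zero}  w y = ≡.refl
  nnz-⊗ {suc m} w y with w zero ≟ 0#
  ... | yes w₀≈0 = ≡.cong₂ _+ℕ_ (nnzV-zero (λ j → trans (*-congʳ w₀≈0) (zeroˡ (y j))))
                                (nnz-⊗ (w ∘ suc) y)
  ... | no w₀≉0  = ≡.cong₂ _+ℕ_ (nnzV-*ₗ y w₀≉0) (nnz-⊗ (w ∘ suc) y)

  ∀-punchIn : ∀ {n q} {P : Fin (suc n) → Set q} (p : Fin (suc n)) →
              P p → (∀ i → P (punchIn p i)) → ∀ r → P r
  ∀-punchIn {P = P} p Pₚ P∘punchIn r with p Fin.≟ r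
  ... | yes ≡.refl = Pₚ
  ... | no p≢r     = ≡.subst P (punchIn-punchOut p≢r) (P∘punchIn (punchOut p≢r))

  module Pivot {m n} (V : Matrix m (suc n)) (p : Fin m) (vₚ≉0 : ¬ V p zero ≈ 0#) where

    v⁻¹ : Carrier
    v⁻¹ = proj₁ (inverse (V p zero) vₚ≉0)

    multiplier : Fin m → Carrier
    multiplier r = V r zero * - v⁻¹

    eliminate : Matrix m n
    eliminate r j = V r (suc j) + multiplier r * V p (suc j)

    backSubstitute : Vector n → Vector (suc n)
    backSubstitute y = - v⁻¹ * ∑ (λ j → V p (suc j) * y j) ∷ᵥ y

    eliminate-pivot-row : ∀ j → eliminate p j ≈ 0#
    eliminate-pivot-row j = x+a*-b*x≈0 (proj₂ (inverse (V p zero) vₚ≉0)) (V p (suc j))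

    ▷-backSubstitute : ∀ y → V ▷ backSubstitute y ≋ eliminate ▷ y
    ▷-backSubstitute y r = begin
      V r zero * (- v⁻¹ * S) + T                          ≈⟨ +-congʳ (*-assoc (V r zero) (- v⁻¹) S) ⟨
      multiplier r * S + T                                ≈⟨ +-comm _ T ⟩
      T + multiplier r * S                                ≈⟨ +-congˡ (*-distribˡ-∑ (multiplier r) Vₚy) ⟩
      T + ∑ (λ j → multiplier r * Vₚy j)                  ≈⟨ ∑-distrib-+ Vᵣy (λ j → multiplier r * Vₚy j) ⟨
      ∑ (λ j → Vᵣy j + multiplier r * Vₚy j)              ≈⟨ ∑-cong expand ⟨
      ∑ (λ j → eliminate r j * y j)                       ∎
      where
      Vₚy Vᵣy : Vector n
      Vₚy j = V p (suc j) * y j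
      Vᵣy j = V r (suc j) * y j
      S = ∑ Vₚy
      T = ∑ Vᵣy
      expand : ∀ j → eliminate r j * y j ≈ Vᵣy j + multiplier r * Vₚy j
      expand j = trans (distribʳ (y j) _ _) (+-congˡ (*-assoc (multiplier r) (V p (suc j)) (y j)))

  ∃-nonzero-kernel : ∀ {m n} → m ≤ n → (V : Matrix m (suc n)) →
                     Σ (Vector (suc n)) λ x → NonZeroV x × V ▷ x ≋ zeroV
  ∃-nonzero-kernel {zero} _ V = 1ᴹ zero , 1ᴹ-nonzero zero , λ ()
  ∃-nonzero-kernel {suc m} {suc n} (s≤s m≤n) V with all? (λ i → V i zero ≟ 0#)
  ... | yes V₀≈0 = 1ᴹ zero , 1ᴹ-nonzero zero , λ i → trans (▷-1ᴹ V zero i) (V₀≈0 i)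
  ... | no V₀≉0 with ¬∀⟶∃¬ _ _ (λ i → V i zero ≟ 0#) V₀≉0
  ...   | p , vₚ≉0 with ∃-nonzero-kernel m≤n (removeAt (Pivot.eliminate V p vₚ≉0) p)
  ...     | y , y≉0 , Wy≈0 = backSubstitute y , (λ x≈0 → y≉0 (x≈0 ∘ suc)) , Vx≈0
    where
    open Pivot V p vₚ≉0
    Vx≈0 : V ▷ backSubstitute y ≋ zeroV
    Vx≈0 r = trans (▷-backSubstitute y r) (∀-punchIn p
      (∑-zero _ (λ j → trans (*-congʳ (eliminate-pivot-row j)) (zeroˡ (y j))))
      Wy≈0 r)

  nnzV-▷-≤-nnz-residual : ∀ {m k n} (A : Matrix m n) (U : Matrix m k) (V : Matrix k n) (x : Vector n) →
                          V ▷ x ≋ zeroV → nnzV (A ▷ x) ≤ nnz ((U · V) ⊖ A)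
  nnzV-▷-≤-nnz-residual A U V x Vx≈0 = nnzV-≤-nnz λ i rowᵢ≈0 → begin
    (A ▷ x) i         ≈⟨ ∑-cong (λ c → *-congʳ (x∙y⁻¹≈ε⇒x≈y _ _ (rowᵢ≈0 c))) ⟨
    ((U · V) ▷ x) i   ≈⟨ ·-▷ U V x i ⟩
    (U ▷ (V ▷ x)) i   ≈⟨ ∑-zero _ (λ t → trans (*-congˡ (Vx≈0 t)) (zeroʳ (U i t))) ⟩
    0#                ∎

  module RankOneCorrection {m n} (A : Matrix m (suc n)) (x : Vector (suc n))
                           (j : Fin (suc n)) (xⱼ≉0 : ¬ x j ≈ 0#) where

    x⁻¹ : Carrier
    x⁻¹ = proj₁ (inverse (x j) xⱼ≉0)

    xⱼx⁻¹≈1 : x j * x⁻¹ ≈ 1#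
    xⱼx⁻¹≈1 = proj₂ (inverse (x j) xⱼ≉0)

    y : Vector (suc n)
    y = λ c → - x⁻¹ * 1ᴹ j c

    P : Matrix (suc n) (suc n)
    P c′ c = 1ᴹ c′ c + (x ⊗ y) c′ c

    P-row≈0 : ∀ c → P j c ≈ 0#
    P-row≈0 c = trans (+-congˡ (sym (*-assoc (x j) (- x⁻¹) (1ᴹ j c)))) (x+a*-b*x≈0 xⱼx⁻¹≈1 (1ᴹ j c))

    U : Matrix m n
    U i = removeAt (A i) j

    V : Matrix n (suc n)
    V = removeAt P j

    residual≈ : ∀ i c → ((U · V) ⊖ A) i c ≈ ((A ▷ x) ⊗ y) i c
    residual≈ i c = begin
      (U · V) i c - A i c                       ≈⟨ +-congʳ (·-removeAt A P j P-row≈0 i c) ⟩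
      ∑ (λ t → A i t * P t c) - A i c           ≈⟨ +-congʳ (∑-cong (λ t → distribˡ (A i t) (1ᴹ t c) (x t * y c))) ⟩
      ∑ (λ t → a₁ t + a₂ t) - A i c             ≈⟨ +-congʳ (∑-distrib-+ a₁ a₂) ⟩
      (A · 1ᴹ) i c + (A · (x ⊗ y)) i c - A i c  ≈⟨ +-congʳ (+-cong (·-identityʳ A i c) (·-⊗ A x y i c)) ⟩
      A i c + ((A ▷ x) ⊗ y) i c - A i c         ≈⟨ xyx⁻¹≈y (A i c) _ ⟩
      ((A ▷ x) ⊗ y) i c                         ∎
      where
      a₁ a₂ : Vector (suc n)
      a₁ t = A i t * 1ᴹ t c
      a₂ t = A i t * (x ⊗ y) t c

    nnz-residual : nnz ((U · V) ⊖ A) ≡ nnzV (A ▷ x)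
    nnz-residual =
      ≡.trans (nnz-cong residual≈) (≡.trans (nnz-⊗ (A ▷ x) y)
        (≡.trans (≡.cong (nnzV (A ▷ x) *ℕ_) nnzV-y) (ℕ-*-identityʳ (nnzV (A ▷ x)))))
      where
      nnzV-y : nnzV y ≡ 1
      nnzV-y = ≡.trans (nnzV-*ₗ (1ᴹ j) (unit⇒≉0 (-‿unit (trans (*-comm x⁻¹ (x j)) xⱼx⁻¹≈1))))
                       (nnzV-1ᴹ j)

  open Surjection enumerate using (to; strictlySurjective)

  vectors : ∀ d → List (Vector d)
  vectors zero    = []ᵥ ∷ []
  vectors (suc d) = cartesianProductWith _∷ᵥ_ (map to (allFin size)) (vectors d)

  vectors-cover : ∀ {d} (x : Vector d) → Σ (Vector d) λ y → y ∈ vectors d × y ≋ x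
  vectors-cover {zero}  x = []ᵥ , here ≡.refl , λ ()
  vectors-cover {suc d} x with strictlySurjective (x zero) | vectors-cover (x ∘ suc)
  ... | a , a≈x₀ | y , y∈vectors , y≋x′ =
    to a ∷ᵥ y ,
    ∈-cartesianProductWith⁺ _∷ᵥ_ (∈-map⁺ to (∈-allFin a)) y∈vectors ,
    λ { zero → a≈x₀ ; (suc i) → y≋x′ i }

  minimum-over-nonzero : ∀ {d} (g : Vector (suc d) → ℕ) → (∀ {x y} → x ≋ y → g x ≡ g y) →
                         Σ ℕ (IsMinOn NonZeroV g)
  minimum-over-nonzero {d} g g-cong =
    minimum-from-cover NonZeroV nonzero? g (vectors (suc d)) cover (1ᴹ zero) (1ᴹ-nonzero zero)
    where
    nonzero? : Decidable (NonZeroV {suc d})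
    nonzero? x = ¬? (all? (λ j → x j ≟ 0#))
    cover : ∀ x → NonZeroV x → Σ (Vector (suc d)) λ y → y ∈ vectors (suc d) × NonZeroV y × g y ≤ g x
    cover x x≉0 with vectors-cover x
    ... | y , y∈vectors , y≋x =
      y , y∈vectors , (λ y≈0 → x≉0 (λ j → trans (sym (y≋x j)) (y≈0 j))) , ≤-reflexive (g-cong y≋x)

  residual-minimum : ∀ {n k} (A : Matrix n (suc k)) {m} →
                     IsMinOn NonZeroV (λ x → nnzV (A ▷ x)) m →
                     IsMin (uncurry λ (U : Matrix n k) (V : Matrix k (suc k)) → nnz ((U · V) ⊖ A)) m
  residual-minimum A {m} ((x , x≉0 , ‖Ax‖≡m) , minimal) with ¬∀⟶∃¬ _ _ (λ j → x j ≟ 0#) x≉0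
  ... | j , xⱼ≉0 = ((U , V) , ≡.trans nnz-residual ‖Ax‖≡m) , lower
    where
    open RankOneCorrection A x j xⱼ≉0
    lower : ∀ UV → m ≤ nnz ((proj₁ UV · proj₂ UV) ⊖ A)
    lower (U′ , V′) with ∃-nonzero-kernel ≤-refl V′
    ... | z , z≉0 , V′z≈0 = ≤-trans (minimal z z≉0) (nnzV-▷-≤-nnz-residual A U′ V′ z V′z≈0)

lemma1p3 : {c ℓ : Level} (F : FiniteField c ℓ) (n k : ℕ) →
    let open Matrices F in
    (A : Matrix n (suc k)) → suc k ≤ n →
    Σ ℕ λ m →
      IsMin (uncurry λ (U : Matrix n k) (V : Matrix k (suc k)) → nnz ((U · V) ⊖ A)) m
      × IsMinOn (λ (x : Vector (suc k)) → NonZeroV x) (λ x → nnzV (A ▷ x)) m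
lemma1p3 F n k A _ =
  let m , minimum = minimum-over-nonzero (λ x → nnzV (A ▷ x)) (λ x≋y → nnzV-cong (▷-congʳ A x≋y))
  in m , residual-minimum A minimum , minimum
  where open LowRankApproximation F; open Matrices F
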